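{- Let $G$ be a weak framework for a $3$-connected matroid $M$ with $|E(M)|\ge 4$, and suppose $G$ has no isolated vertices. Then either (a) $G$ is connected, (b) $G$ has exactly two components, one of which is a loop-component, or (c) every component of $G$ is a loop-component.
   Context: For a graph $G$ and a vertex $v$, $\mathrm{loops}_G(v)$ denotes the set of loop-edges of $G$ at $v$. Graphs are finite and may have loops and parallel edges. A graph $G$ is a weak framework for a matroid $M$ if (1) $E(G)=E(M)$; (2) $r_M(E(H))\le |V(H)|$ for each component $H$ of $G$; and (3) for each vertex $v$ of $G$, $\mathrm{cl}_M(E(G-v))\subseteq E(G-v)\cup \mathrm{loops}_G(v)$. A loop-component of a graph is a component consisting of exactly one vertex and exactly one edge. -}

module Defs where

open import Data.Nat using (ℕ; _≤_; _<_; _+_)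
open import Data.Bool using (Bool; true; false; _∨_; _∧_; not)
open import Data.Fin using (Fin; _≟_)
open import Data.Fin.Subset using (Subset; _∪_; _∩_; _⊆_; ∁; ⁅_⁆; ∣_∣; ⊤; ⊥; _∈_)
open import Data.Vec using (tabulate; lookup)
open import Data.Product using (_×_; proj₁; proj₂; Σ; ∃; _,_)
open import Data.Sum using (_⊎_)
open import Relation.Nullary using (¬_; Dec)
open import Relation.Nullary.Decidable using (⌊_⌋)
open import Relation.Binary.PropositionalEquality using (_≡_; _≢_)

record Matroid (n : ℕ) : Set where
  field
    rank       : Subset n → ℕ
    rank-≤-card : ∀ X → rank X ≤ ∣ X ∣
    rank-mono   : ∀ {X Y} → X ⊆ Y → rank X ≤ rank Y
    rank-submod : ∀ X Y → rank (X ∪ Y) + rank (X ∩ Y) ≤ rank X + rank Y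

open Matroid public

InClosure : ∀ {n} → Matroid n → Subset n → Fin n → Set
InClosure M X e = rank M (X ∪ ⁅ e ⁆) ≡ rank M X

IsSeparation : ∀ {n} → Matroid n → ℕ → Subset n → Set
IsSeparation M k X =
  k ≤ ∣ X ∣ × k ≤ ∣ ∁ X ∣ × rank M X + rank M (∁ X) < rank M ⊤ + k

ThreeConnected : ∀ {n} → Matroid n → Set
ThreeConnected M = ∀ k → k < 3 → ∀ X → ¬ IsSeparation M k X

-- Graphs with vertex set Fin m and edge set Fin n; loops and parallel
-- edges allowed.  Each edge has an (unordered) pair of ends.

record Graph (m n : ℕ) : Set where
  field
    ends : Fin n → Fin m × Fin m

open Graph public

module _ {m n : ℕ} (G : Graph m n) where

  Incident : Fin m → Fin n → Set
  Incident v e = proj₁ (ends G e) ≡ v ⊎ proj₂ (ends G e) ≡ v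

  incident? : Fin m → Fin n → Bool
  incident? v e = ⌊ proj₁ (ends G e) ≟ v ⌋ ∨ ⌊ proj₂ (ends G e) ≟ v ⌋

  IsLoopAt : Fin m → Fin n → Set
  IsLoopAt v e = proj₁ (ends G e) ≡ v × proj₂ (ends G e) ≡ v

  edgesMinus : Fin m → Subset n
  edgesMinus v = tabulate (λ e → not (incident? v e))

  data Reach : Fin m → Fin m → Set where
    here  : ∀ {u} → Reach u u
    step₁ : ∀ {u w} (e : Fin n) → proj₁ (ends G e) ≡ u → Reach (proj₂ (ends G e)) w → Reach u w
    step₂ : ∀ {u w} (e : Fin n) → proj₂ (ends G e) ≡ u → Reach (proj₁ (ends G e)) w → Reach u w

  IsComponent : Subset m → Set
  IsComponent S =
    (∃ λ v → v ∈ S) ×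
    (∀ e → proj₁ (ends G e) ∈ S → proj₂ (ends G e) ∈ S) ×
    (∀ e → proj₂ (ends G e) ∈ S → proj₁ (ends G e) ∈ S) ×
    (∀ u w → u ∈ S → w ∈ S → Reach u w)

  edgesOf : Subset m → Subset n
  edgesOf S = tabulate (λ e → lookup S (proj₁ (ends G e)) ∨ lookup S (proj₂ (ends G e)))

  IsLoopComponent : Subset m → Set
  IsLoopComponent S = IsComponent S × ∣ S ∣ ≡ 1 × ∣ edgesOf S ∣ ≡ 1

  Connected : Set
  Connected = 0 < m × (∀ u w → Reach u w)

  NoIsolatedVertices : Set
  NoIsolatedVertices = ∀ v → ∃ λ e → Incident v e

  -- G is a weak framework for M (E(G) = E(M) = Fin n is built in)
  IsWeakFramework : Matroid n → Set
  IsWeakFramework M =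
    (∀ S → IsComponent S → rank M (edgesOf S) ≤ ∣ S ∣) ×
    (∀ v e → InClosure M (edgesMinus v) e → ¬ Incident v e ⊎ IsLoopAt v e)

-- Let S be a component with edge set A, and B = E − A.  Grow a spanning
-- tree of S from one vertex: each new tree edge e is a non-loop at its new
-- end v, and B together with the edges induced by the old vertices lies in
-- E(G − v), so by condition (3) adding e raises the rank.  Hence
-- r(B) + |S| ≤ r(M) + 1, and with condition (2), r(A) + r(B) ≤ r(M) + 1.
-- Three-connectivity then forbids |A|, |B| ≥ 2; and when |A| = 1 and S misses
-- a vertex it forbids |S| ≥ 2, so S is a loop-component.  A component with at
-- least two edges thus leaves at most one edge for all other components,
-- hence exactly one other component, a loop-component.

module Submission where

open import Defs
open import Data.Bool using (Bool; true; false; _∨_; _∧_; not)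
import Data.Bool as Bool
open import Data.Fin using (Fin; _≟_) renaming (zero to fzero)
open import Data.Fin.Properties using (any?; nonZeroIndex)
open import Data.Fin.Subset using (Subset; _∪_; _∩_; _⊆_; ∁; ⁅_⁆; ∣_∣; ⊤; _∈_; _∉_)
open import Data.Fin.Subset.Properties
  using (_∈?_; ∣p∣≤n; x∈⁅x⁆; x∈⁅y⁆⇒x≡y; ∣⁅x⁆∣≡1; ⊆-antisym; ⊆⊤; p⊆q⇒∣p∣≤∣q∣; p⊂q⇒∣p∣<∣q∣;
         x∈∁p⇒x∉p; x∉p⇒x∈∁p; x∈p∩q⁺; x∈p∪q⁻; x∈p∪q⁺; p⊆p∪q; q⊆p∪q; x∈p⇒∣p-x∣<∣p∣; x∈p∧x≢y⇒x∈p-y)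
open import Data.Nat using (ℕ; suc; _≤_; _<_; _+_; _∸_; z≤n; s≤s; _≤?_; >-nonZero⁻¹)
open import Data.Nat.Induction using (<-wellFounded)
open import Data.Nat.Properties
  using (≤-trans; ≤-antisym; ≤-reflexive; ≤-pred; ≤∧≢⇒<; ≰⇒>; n≤1+n; +-comm; +-suc;
         +-mono-≤; +-monoˡ-≤; +-monoʳ-≤; +-cancelˡ-≤; ∸-monoʳ-<; module ≤-Reasoning)
open import Data.Product using (_×_; _,_; proj₁; proj₂; ∃; ∃₂)
open import Data.Sum using (_⊎_; inj₁; inj₂; [_,_]′)
import Data.Sum as Sum
open import Data.Vec using ([]; _∷_; tabulate; lookup)
open import Data.Vec.Properties using (lookup∘tabulate; []=⇒lookup; lookup⇒[]=; ≡-dec)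
open import Induction.WellFounded using (Acc; acc)
open import Relation.Nullary using (¬_; yes; no)
open import Relation.Nullary.Decidable using (⌊_⌋; ¬?; _×-dec_; _⊎-dec_; decidable-stable; dec-false; isYes≗does)
open import Relation.Binary.PropositionalEquality
  using (_≡_; _≢_; refl; sym; trans; cong; cong₂; subst; ≢-sym)

∈-tabulate⁺ : ∀ {k} (f : Fin k → Bool) {i} → f i ≡ true → i ∈ tabulate f
∈-tabulate⁺ f {i} fi≡true = lookup⇒[]= i (tabulate f) (trans (lookup∘tabulate f i) fi≡true)

∈-tabulate⁻ : ∀ {k} (f : Fin k → Bool) {i} → i ∈ tabulate f → f i ≡ true
∈-tabulate⁻ f {i} i∈ = trans (sym (lookup∘tabulate f i)) ([]=⇒lookup i∈)

∨≡true⁺ : ∀ a {b} → a ≡ true ⊎ b ≡ true → a ∨ b ≡ true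
∨≡true⁺ true  _         = refl
∨≡true⁺ false (inj₂ b≡) = b≡

∨≡true⁻ : ∀ a {b} → a ∨ b ≡ true → a ≡ true ⊎ b ≡ true
∨≡true⁻ true  _  = inj₁ refl
∨≡true⁻ false b≡ = inj₂ b≡

∧≡true⁻ : ∀ a {b} → a ∧ b ≡ true → a ≡ true × b ≡ true
∧≡true⁻ true b≡ = refl , b≡

∣p∪q∣≤∣p∣+∣q∣ : ∀ {k} (p q : Subset k) → ∣ p ∪ q ∣ ≤ ∣ p ∣ + ∣ q ∣
∣p∪q∣≤∣p∣+∣q∣ []          []          = z≤n
∣p∪q∣≤∣p∣+∣q∣ (true ∷ p)  (true ∷ q)  = s≤s (≤-trans (∣p∪q∣≤∣p∣+∣q∣ p q) (+-monoʳ-≤ ∣ p ∣ (n≤1+n ∣ q ∣)))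
∣p∪q∣≤∣p∣+∣q∣ (true ∷ p)  (false ∷ q) = s≤s (∣p∪q∣≤∣p∣+∣q∣ p q)
∣p∪q∣≤∣p∣+∣q∣ (false ∷ p) (true ∷ q)  = ≤-trans (s≤s (∣p∪q∣≤∣p∣+∣q∣ p q)) (≤-reflexive (sym (+-suc ∣ p ∣ ∣ q ∣)))
∣p∪q∣≤∣p∣+∣q∣ (false ∷ p) (false ∷ q) = ∣p∪q∣≤∣p∣+∣q∣ p q

module _ {k : ℕ} where

  ∪-least : {p q r : Subset k} → p ⊆ r → q ⊆ r → p ∪ q ⊆ r
  ∪-least {p} {q} p⊆r q⊆r x∈ = [ p⊆r , q⊆r ]′ (x∈p∪q⁻ p q x∈)

  x∈p⇒⁅x⁆⊆p : ∀ {x} {p : Subset k} → x ∈ p → ⁅ x ⁆ ⊆ p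
  x∈p⇒⁅x⁆⊆p {x} x∈p y∈⁅x⁆ = subst (_∈ _) (sym (x∈⁅y⁆⇒x≡y x y∈⁅x⁆)) x∈p

  x∈p∧y∉p⇒x≢y : ∀ {x y} {p : Subset k} → x ∈ p → y ∉ p → x ≢ y
  x∈p∧y∉p⇒x≢y x∈p y∉p refl = y∉p x∈p

  x∈p⇒0<∣p∣ : ∀ {x} {p : Subset k} → x ∈ p → 0 < ∣ p ∣
  x∈p⇒0<∣p∣ x∈p = ≤-trans (s≤s z≤n) (x∈p⇒∣p-x∣<∣p∣ x∈p)

  x≢y∈p⇒2≤∣p∣ : ∀ {x y} {p : Subset k} → x ∈ p → y ∈ p → x ≢ y → 2 ≤ ∣ p ∣
  x≢y∈p⇒2≤∣p∣ x∈p y∈p x≢y = ≤-trans (s≤s (x∈p⇒0<∣p∣ (x∈p∧x≢y⇒x∈p-y y∈p (≢-sym x≢y)))) (x∈p⇒∣p-x∣<∣p∣ x∈p)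

  ∣p∣<2⇒unique : ∀ {x y} {p : Subset k} → ¬ 2 ≤ ∣ p ∣ → x ∈ p → y ∈ p → x ≡ y
  ∣p∣<2⇒unique {x} {y} few x∈p y∈p =
    decidable-stable (x ≟ y) (λ x≢y → few (x≢y∈p⇒2≤∣p∣ x∈p y∈p x≢y))

  unique⇒∣p∣≡1 : ∀ {x} {p : Subset k} → x ∈ p → (∀ {y} → y ∈ p → y ≡ x) → ∣ p ∣ ≡ 1
  unique⇒∣p∣≡1 {x} {p} x∈p unique = trans (cong ∣_∣ p≡⁅x⁆) (∣⁅x⁆∣≡1 x)
    where
    p≡⁅x⁆ : p ≡ ⁅ x ⁆
    p≡⁅x⁆ = ⊆-antisym (λ y∈p → subst (_∈ ⁅ x ⁆) (sym (unique y∈p)) (x∈⁅x⁆ x)) (x∈p⇒⁅x⁆⊆p x∈p)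

-- Matroid closure

module _ {n : ℕ} (M : Matroid n) where

  InClosure-mono : ∀ {X Y e} → X ⊆ Y → InClosure M X e → InClosure M Y e
  InClosure-mono {X} {Y} {e} X⊆Y X+e≡X =
    ≤-antisym (+-cancelˡ-≤ (rank M X) _ _ submodular) (rank-mono M (p⊆p∪q ⁅ e ⁆))
    where
    open ≤-Reasoning
    X+e = X ∪ ⁅ e ⁆
    submodular : rank M X + rank M (Y ∪ ⁅ e ⁆) ≤ rank M X + rank M Y
    submodular = begin
      rank M X + rank M (Y ∪ ⁅ e ⁆)
        ≤⟨ +-mono-≤ (rank-mono M (λ x∈X → x∈p∩q⁺ (p⊆p∪q ⁅ e ⁆ x∈X , X⊆Y x∈X)))
                    (rank-mono M (∪-least (q⊆p∪q X+e Y) (λ x∈e → p⊆p∪q Y (q⊆p∪q X ⁅ e ⁆ x∈e)))) ⟩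
      rank M (X+e ∩ Y) + rank M (X+e ∪ Y)  ≡⟨ +-comm (rank M (X+e ∩ Y)) _ ⟩
      rank M (X+e ∪ Y) + rank M (X+e ∩ Y)  ≤⟨ rank-submod M X+e Y ⟩
      rank M X+e + rank M Y                ≡⟨ cong (_+ rank M Y) X+e≡X ⟩
      rank M X + rank M Y                  ∎

  ∉closure⇒rank-suc : ∀ {X e} → ¬ InClosure M X e → suc (rank M X) ≤ rank M (X ∪ ⁅ e ⁆)
  ∉closure⇒rank-suc {e = e} ∉cl = ≤∧≢⇒< (rank-mono M (p⊆p∪q ⁅ e ⁆)) (λ eq → ∉cl (sym eq))

-- Walks and components

module GraphComponents {m n : ℕ} (G : Graph m n) where

  end₁ end₂ : Fin n → Fin m
  end₁ e = proj₁ (ends G e)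
  end₂ e = proj₂ (ends G e)

  Reach-trans : ∀ {u v w} → Reach G u v → Reach G v w → Reach G u w
  Reach-trans here            r = r
  Reach-trans (step₁ e eq r′) r = step₁ e eq (Reach-trans r′ r)
  Reach-trans (step₂ e eq r′) r = step₂ e eq (Reach-trans r′ r)

  Reach-sym : ∀ {u w} → Reach G u w → Reach G w u
  Reach-sym here             = here
  Reach-sym (step₁ e refl r) = Reach-trans (Reach-sym r) (step₂ e refl here)
  Reach-sym (step₂ e refl r) = Reach-trans (Reach-sym r) (step₁ e refl here)

  Closed : Subset m → Set
  Closed W = (∀ e → end₁ e ∈ W → end₂ e ∈ W) × (∀ e → end₂ e ∈ W → end₁ e ∈ W)

  Closed-Reach : ∀ {W x y} → Closed W → x ∈ W → Reach G x y → y ∈ W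
  Closed-Reach _           x∈W here             = x∈W
  Closed-Reach cl@(c₁ , _) x∈W (step₁ e refl r) = Closed-Reach cl (c₁ e x∈W) r
  Closed-Reach cl@(_ , c₂) x∈W (step₂ e refl r) = Closed-Reach cl (c₂ e x∈W) r

  component-closed : ∀ {S} → IsComponent G S → Closed S
  component-closed (_ , c₁ , c₂ , _) = c₁ , c₂

  Joins : Subset m → Fin m → Fin n → Set
  Joins W v e = v ∉ W × (end₁ e ∈ W × end₂ e ≡ v ⊎ end₂ e ∈ W × end₁ e ≡ v)

  closed-or-joins : ∀ W → Closed W ⊎ ∃₂ λ v e → Joins W v e
  closed-or-joins W with any? (λ e → (end₁ e ∈? W ×-dec ¬? (end₂ e ∈? W)) ⊎-dec (end₂ e ∈? W ×-dec ¬? (end₁ e ∈? W)))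
  ... | yes (e , inj₁ (∈W , ∉W)) = inj₂ (end₂ e , e , ∉W , inj₁ (∈W , refl))
  ... | yes (e , inj₂ (∈W , ∉W)) = inj₂ (end₁ e , e , ∉W , inj₂ (∈W , refl))
  ... | no none = inj₁ ( (λ e ∈W → decidable-stable (end₂ e ∈? W) λ ∉W → none (e , inj₁ (∈W , ∉W)))
                       , (λ e ∈W → decidable-stable (end₁ e ∈? W) λ ∉W → none (e , inj₂ (∈W , ∉W))))

  module _ (P : Subset m → Set) (P-step : ∀ {W v e} → Joins W v e → P W → P (⁅ v ⁆ ∪ W)) where

    private
      grow : ∀ W → Acc _<_ (m ∸ ∣ W ∣) → P W → ∃ λ W′ → P W′ × Closed W′
      grow W (acc smaller) pW with closed-or-joins W
      ... | inj₁ closed        = W , pW , closed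
      ... | inj₂ (v , e , joins) = grow (⁅ v ⁆ ∪ W) (smaller shrinks) (P-step joins pW)
        where
        shrinks : m ∸ ∣ ⁅ v ⁆ ∪ W ∣ < m ∸ ∣ W ∣
        shrinks = ∸-monoʳ-< (p⊂q⇒∣p∣<∣q∣ ((λ {x} → q⊆p∪q ⁅ v ⁆ W) , v , x∈p∪q⁺ (inj₁ (x∈⁅x⁆ v)) , proj₁ joins))
                            (∣p∣≤n (⁅ v ⁆ ∪ W))

    closure-induction : ∀ {W} → P W → ∃ λ W′ → P W′ × Closed W′
    closure-induction {W} = grow W (<-wellFounded _)

  Joins-Reach : ∀ {W v e} → Joins W v e → ∃ λ w → w ∈ W × Reach G w v
  Joins-Reach {e = e} (_ , inj₁ (w∈W , refl)) = end₁ e , w∈W , step₁ e refl here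
  Joins-Reach {e = e} (_ , inj₂ (w∈W , refl)) = end₂ e , w∈W , step₂ e refl here

  Joins-Closed : ∀ {S W v e} → Closed S → W ⊆ S → Joins W v e → v ∈ S
  Joins-Closed (c₁ , _) W⊆S (_ , inj₁ (w∈W , refl)) = c₁ _ (W⊆S w∈W)
  Joins-Closed (_ , c₂) W⊆S (_ , inj₂ (w∈W , refl)) = c₂ _ (W⊆S w∈W)

  Joins⇒Incident : ∀ {W v e} → Joins W v e → Incident G v e
  Joins⇒Incident (_ , inj₁ (_ , end₂≡v)) = inj₂ end₂≡v
  Joins⇒Incident (_ , inj₂ (_ , end₁≡v)) = inj₁ end₁≡v

  Joins⇒¬IsLoopAt : ∀ {W v e} → Joins W v e → ¬ IsLoopAt G v e
  Joins⇒¬IsLoopAt {W} (v∉W , inj₁ (w∈W , _)) (end₁≡v , _) = v∉W (subst (_∈ W) end₁≡v w∈W)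
  Joins⇒¬IsLoopAt {W} (v∉W , inj₂ (w∈W , _)) (_ , end₂≡v) = v∉W (subst (_∈ W) end₂≡v w∈W)

  component : ∀ u → ∃ λ S → IsComponent G S × u ∈ S
  component u = toComponent (closure-induction ReachedFrom-u extend (x∈⁅x⁆ u , reach-⁅u⁆))
    where
    ReachedFrom-u : Subset m → Set
    ReachedFrom-u W = u ∈ W × (∀ {w} → w ∈ W → Reach G u w)

    reach-⁅u⁆ : ∀ {w} → w ∈ ⁅ u ⁆ → Reach G u w
    reach-⁅u⁆ w∈ = subst (Reach G u) (sym (x∈⁅y⁆⇒x≡y u w∈)) here

    extend : ∀ {W v e} → Joins W v e → ReachedFrom-u W → ReachedFrom-u (⁅ v ⁆ ∪ W)
    extend {W} {v} joins (u∈W , reach) = q⊆p∪q ⁅ v ⁆ W u∈W , λ x∈ → [ reach-v , reach ]′ (x∈p∪q⁻ ⁅ v ⁆ W x∈)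
      where
      reach-v : ∀ {x} → x ∈ ⁅ v ⁆ → Reach G u x
      reach-v x∈ with Joins-Reach joins
      ... | w , w∈W , w⇝v = subst (Reach G u) (sym (x∈⁅y⁆⇒x≡y v x∈)) (Reach-trans (reach w∈W) w⇝v)

    toComponent : (∃ λ W → ReachedFrom-u W × Closed W) → ∃ λ S → IsComponent G S × u ∈ S
    toComponent (S , (u∈S , reach) , c₁ , c₂) =
      S , ((u , u∈S) , c₁ , c₂ , λ x y x∈ y∈ → Reach-trans (Reach-sym (reach x∈)) (reach y∈)) , u∈S

  component-⊆ : ∀ {S T y} → IsComponent G S → IsComponent G T → y ∈ S → y ∈ T → T ⊆ S
  component-⊆ cS (_ , _ , _ , connT) y∈S y∈T t∈T = Closed-Reach (component-closed cS) y∈S (connT _ _ y∈T t∈T)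

  component-≡ : ∀ {S T y} → IsComponent G S → IsComponent G T → y ∈ S → y ∈ T → S ≡ T
  component-≡ cS cT y∈S y∈T = ⊆-antisym (component-⊆ cT cS y∈T y∈S) (component-⊆ cS cT y∈S y∈T)

  NoSpanningComponent : Set
  NoSpanningComponent = ∀ {S} → IsComponent G S → ∃ λ z → z ∉ S

  connected-or-noSpanningComponent : Fin m → Connected G ⊎ NoSpanningComponent
  connected-or-noSpanningComponent u with component u
  ... | C , cC@(_ , _ , _ , connC) , u∈C with any? (λ w → ¬? (w ∈? C))
  ...   | yes (w , w∉C) = inj₂ outside
    where
    outside : NoSpanningComponent
    outside {S} cS with u ∈? S
    ... | no u∉S  = u , u∉S
    ... | yes u∈S = w , λ w∈S → w∉C (component-⊆ cC cS u∈C u∈S w∈S)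
  ...   | no none = inj₁ (>-nonZero⁻¹ m {{nonZeroIndex u}} , λ x y → connC x y (∈C x) (∈C y))
    where
    ∈C : ∀ x → x ∈ C
    ∈C x = decidable-stable (x ∈? C) λ x∉C → none (x , x∉C)

  ∈-edgesOf⁺ : ∀ {S e} → end₁ e ∈ S ⊎ end₂ e ∈ S → e ∈ edgesOf G S
  ∈-edgesOf⁺ {S} {e} end∈S =
    ∈-tabulate⁺ _ (∨≡true⁺ (lookup S (end₁ e)) (Sum.map []=⇒lookup []=⇒lookup end∈S))

  ∈-edgesOf⁻ : ∀ {S e} → e ∈ edgesOf G S → end₁ e ∈ S ⊎ end₂ e ∈ S
  ∈-edgesOf⁻ {S} {e} e∈ =
    Sum.map (lookup⇒[]= _ S) (lookup⇒[]= _ S) (∨≡true⁻ (lookup S (end₁ e)) (∈-tabulate⁻ _ e∈))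

  Incident⇒∈edgesOf : ∀ {S v e} → v ∈ S → Incident G v e → e ∈ edgesOf G S
  Incident⇒∈edgesOf v∈S (inj₁ refl) = ∈-edgesOf⁺ (inj₁ v∈S)
  Incident⇒∈edgesOf v∈S (inj₂ refl) = ∈-edgesOf⁺ (inj₂ v∈S)

  ∉edgesOf⇒ends∉ : ∀ {S e} → e ∉ edgesOf G S → end₁ e ∉ S × end₂ e ∉ S
  ∉edgesOf⇒ends∉ e∉ = (λ ∈S → e∉ (∈-edgesOf⁺ (inj₁ ∈S))) , (λ ∈S → e∉ (∈-edgesOf⁺ (inj₂ ∈S)))

  ∈edgesOf⇒end₁∈ : ∀ {S e} → Closed S → e ∈ edgesOf G S → end₁ e ∈ S
  ∈edgesOf⇒end₁∈ (_ , c₂) e∈ = [ (λ ∈S → ∈S) , c₂ _ ]′ (∈-edgesOf⁻ e∈)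

  ∈edgesOf∧Incident⇒∈ : ∀ {S v e} → Closed S → e ∈ edgesOf G S → Incident G v e → v ∈ S
  ∈edgesOf∧Incident⇒∈ cl           e∈ (inj₁ refl) = ∈edgesOf⇒end₁∈ cl e∈
  ∈edgesOf∧Incident⇒∈ cl@(c₁ , _) e∈ (inj₂ refl) = c₁ _ (∈edgesOf⇒end₁∈ cl e∈)

  edgesOf-meet⇒≡ : ∀ {S T e} → IsComponent G S → IsComponent G T →
                   e ∈ edgesOf G S → e ∈ edgesOf G T → S ≡ T
  edgesOf-meet⇒≡ cS cT e∈S e∈T =
    component-≡ cS cT (∈edgesOf⇒end₁∈ (component-closed cS) e∈S) (∈edgesOf⇒end₁∈ (component-closed cT) e∈T)

  ≢⇒edgesOf⊆∁edgesOf : ∀ {S T} → IsComponent G S → IsComponent G T → S ≢ T →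
                       edgesOf G T ⊆ ∁ (edgesOf G S)
  ≢⇒edgesOf⊆∁edgesOf cS cT S≢T e∈T = x∉p⇒x∈∁p λ e∈S → S≢T (edgesOf-meet⇒≡ cS cT e∈S e∈T)

  inducedEdges : Subset m → Subset n
  inducedEdges W = tabulate λ e → lookup W (end₁ e) ∧ lookup W (end₂ e)

  ∈-inducedEdges⁺ : ∀ {W e} → end₁ e ∈ W → end₂ e ∈ W → e ∈ inducedEdges W
  ∈-inducedEdges⁺ end₁∈ end₂∈ = ∈-tabulate⁺ _ (cong₂ _∧_ ([]=⇒lookup end₁∈) ([]=⇒lookup end₂∈))

  ∈-inducedEdges⁻ : ∀ {W e} → e ∈ inducedEdges W → end₁ e ∈ W × end₂ e ∈ W
  ∈-inducedEdges⁻ {W} {e} e∈ with ∧≡true⁻ (lookup W (end₁ e)) (∈-tabulate⁻ _ e∈)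
  ... | end₁∈ , end₂∈ = lookup⇒[]= _ W end₁∈ , lookup⇒[]= _ W end₂∈

  inducedEdges-mono : ∀ {W W′} → W ⊆ W′ → inducedEdges W ⊆ inducedEdges W′
  inducedEdges-mono W⊆W′ e∈ with ∈-inducedEdges⁻ e∈
  ... | end₁∈ , end₂∈ = ∈-inducedEdges⁺ (W⊆W′ end₁∈) (W⊆W′ end₂∈)

  Joins⇒∈inducedEdges : ∀ {W v e} → Joins W v e → e ∈ inducedEdges (⁅ v ⁆ ∪ W)
  Joins⇒∈inducedEdges {W} {v} (_ , inj₁ (end₁∈ , refl)) =
    ∈-inducedEdges⁺ (q⊆p∪q ⁅ v ⁆ W end₁∈) (p⊆p∪q W (x∈⁅x⁆ v))
  Joins⇒∈inducedEdges {W} {v} (_ , inj₂ (end₂∈ , refl)) =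
    ∈-inducedEdges⁺ (p⊆p∪q W (x∈⁅x⁆ v)) (q⊆p∪q ⁅ v ⁆ W end₂∈)

  ∈-edgesMinus⁺ : ∀ {v e} → end₁ e ≢ v → end₂ e ≢ v → e ∈ edgesMinus G v
  ∈-edgesMinus⁺ {v} {e} end₁≢v end₂≢v =
    ∈-tabulate⁺ _ (cong₂ (λ a b → not (a ∨ b)) (⌊≟v⌋≡false end₁≢v) (⌊≟v⌋≡false end₂≢v))
    where
    ⌊≟v⌋≡false : ∀ {x} → x ≢ v → ⌊ x ≟ v ⌋ ≡ false
    ⌊≟v⌋≡false {x} x≢v = trans (isYes≗does (x ≟ v)) (dec-false (x ≟ v) x≢v)

-- The rank of the edges outside a component

module WeakFrameworkRank {m n : ℕ} {M : Matroid n} {G : Graph m n} (fw : IsWeakFramework G M) where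
  open GraphComponents G
  open ≤-Reasoning

  nonloop-rank-suc : ∀ {X v e} → Incident G v e → ¬ IsLoopAt G v e → X ⊆ edgesMinus G v →
                     suc (rank M X) ≤ rank M (X ∪ ⁅ e ⁆)
  nonloop-rank-suc incident ¬loop X⊆ =
    ∉closure⇒rank-suc M λ e∈cl → [ (λ ¬incident → ¬incident incident) , ¬loop ]′
                                   (proj₂ fw _ _ (InClosure-mono M X⊆ e∈cl))

  module _ {S : Subset m} (cS : IsComponent G S) where

    private
      B = ∁ (edgesOf G S)
      u = proj₁ (proj₁ cS)
      closedS = component-closed cS

      Invariant : Subset m → Set
      Invariant W = W ⊆ S × u ∈ W × rank M B + ∣ W ∣ ≤ rank M (B ∪ inducedEdges W) + 1

      base : Invariant ⁅ u ⁆
      base = x∈p⇒⁅x⁆⊆p (proj₂ (proj₁ cS)) , x∈⁅x⁆ u ,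
             subst (λ k → rank M B + k ≤ rank M (B ∪ inducedEdges ⁅ u ⁆) + 1) (sym (∣⁅x⁆∣≡1 u))
                   (+-monoˡ-≤ 1 (rank-mono M (p⊆p∪q (inducedEdges ⁅ u ⁆))))

      step : ∀ {W v e} → Joins W v e → Invariant W → Invariant (⁅ v ⁆ ∪ W)
      step {W} {v} {e} joins (W⊆S , u∈W , bound) = ∪-least (x∈p⇒⁅x⁆⊆p v∈S) W⊆S , q⊆p∪q ⁅ v ⁆ W u∈W , bound′
        where
        v∈S = Joins-Closed closedS W⊆S joins
        old = B ∪ inducedEdges W

        old⊆edgesMinus : old ⊆ edgesMinus G v
        old⊆edgesMinus = ∪-least
          (λ i∈B → let ∉S = ∉edgesOf⇒ends∉ (x∈∁p⇒x∉p i∈B) in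
                   ∈-edgesMinus⁺ (≢-sym (x∈p∧y∉p⇒x≢y v∈S (proj₁ ∉S))) (≢-sym (x∈p∧y∉p⇒x≢y v∈S (proj₂ ∉S))))
          (λ i∈ → let ∈W = ∈-inducedEdges⁻ i∈ in
                  ∈-edgesMinus⁺ (x∈p∧y∉p⇒x≢y (proj₁ ∈W) (proj₁ joins)) (x∈p∧y∉p⇒x≢y (proj₂ ∈W) (proj₁ joins)))

        old+e⊆new : old ∪ ⁅ e ⁆ ⊆ B ∪ inducedEdges (⁅ v ⁆ ∪ W)
        old+e⊆new = ∪-least
          (∪-least (p⊆p∪q _) (λ i∈ → q⊆p∪q B _ (inducedEdges-mono (q⊆p∪q ⁅ v ⁆ W) i∈)))
          (x∈p⇒⁅x⁆⊆p (q⊆p∪q B _ (Joins⇒∈inducedEdges joins)))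

        bound′ : rank M B + ∣ ⁅ v ⁆ ∪ W ∣ ≤ rank M (B ∪ inducedEdges (⁅ v ⁆ ∪ W)) + 1
        bound′ = begin
          rank M B + ∣ ⁅ v ⁆ ∪ W ∣
            ≤⟨ +-monoʳ-≤ (rank M B) (subst (λ k → ∣ ⁅ v ⁆ ∪ W ∣ ≤ k + ∣ W ∣) (∣⁅x⁆∣≡1 v) (∣p∪q∣≤∣p∣+∣q∣ ⁅ v ⁆ W)) ⟩
          rank M B + suc ∣ W ∣           ≡⟨ +-suc (rank M B) ∣ W ∣ ⟩
          suc (rank M B + ∣ W ∣)         ≤⟨ s≤s bound ⟩
          suc (rank M old) + 1           ≤⟨ +-monoˡ-≤ 1 (nonloop-rank-suc (Joins⇒Incident joins) (Joins⇒¬IsLoopAt joins) old⊆edgesMinus) ⟩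
          rank M (old ∪ ⁅ e ⁆) + 1       ≤⟨ +-monoˡ-≤ 1 (rank-mono M old+e⊆new) ⟩
          rank M (B ∪ inducedEdges (⁅ v ⁆ ∪ W)) + 1 ∎

    rank∁edgesOf+∣S∣≤rank+1 : rank M (∁ (edgesOf G S)) + ∣ S ∣ ≤ rank M ⊤ + 1
    rank∁edgesOf+∣S∣≤rank+1 with closure-induction Invariant step base
    ... | W , (_ , u∈W , bound) , closedW = begin
      rank M B + ∣ S ∣                  ≤⟨ +-monoʳ-≤ (rank M B) (p⊆q⇒∣p∣≤∣q∣ S⊆W) ⟩
      rank M B + ∣ W ∣                  ≤⟨ bound ⟩
      rank M (B ∪ inducedEdges W) + 1   ≤⟨ +-monoˡ-≤ 1 (rank-mono M ⊆⊤) ⟩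
      rank M ⊤ + 1                      ∎
      where
      S⊆W : S ⊆ W
      S⊆W x∈S = Closed-Reach closedW u∈W (proj₂ (proj₂ (proj₂ cS)) u _ (proj₂ (proj₁ cS)) x∈S)

module ThreeConnectedFramework {m n : ℕ} {M : Matroid n} {G : Graph m n}
  (tc : ThreeConnected M) (fw : IsWeakFramework G M) (ni : NoIsolatedVertices G) where
  open GraphComponents G
  open WeakFrameworkRank {M = M} fw
  open ≤-Reasoning

  some-edge : ∀ {S} → IsComponent G S → ∃ λ e → e ∈ edgesOf G S
  some-edge ((u , u∈S) , _) = proj₁ (ni u) , Incident⇒∈edgesOf u∈S (proj₂ (ni u))

  rank-edgesOf+rank∁edgesOf≤rank+1 : ∀ {S} → IsComponent G S →
    rank M (edgesOf G S) + rank M (∁ (edgesOf G S)) ≤ rank M ⊤ + 1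
  rank-edgesOf+rank∁edgesOf≤rank+1 {S} cS = begin
    rank M (edgesOf G S) + rank M (∁ (edgesOf G S))  ≤⟨ +-monoˡ-≤ _ (proj₁ fw S cS) ⟩
    ∣ S ∣ + rank M (∁ (edgesOf G S))                  ≡⟨ +-comm ∣ S ∣ _ ⟩
    rank M (∁ (edgesOf G S)) + ∣ S ∣                  ≤⟨ rank∁edgesOf+∣S∣≤rank+1 cS ⟩
    rank M ⊤ + 1                                      ∎

  2≤∣edgesOf∣⇒∣∁edgesOf∣<2 : ∀ {S} → IsComponent G S → 2 ≤ ∣ edgesOf G S ∣ → ¬ 2 ≤ ∣ ∁ (edgesOf G S) ∣
  2≤∣edgesOf∣⇒∣∁edgesOf∣<2 {S} cS many many∁ = tc 2 (s≤s (s≤s (s≤s z≤n))) (edgesOf G S) (many , many∁ , bound)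
    where
    bound : rank M (edgesOf G S) + rank M (∁ (edgesOf G S)) < rank M ⊤ + 2
    bound = ≤-trans (s≤s (rank-edgesOf+rank∁edgesOf≤rank+1 cS)) (≤-reflexive (sym (+-suc (rank M ⊤) 1)))

  loop-component : ∀ {S} → IsComponent G S → (∃ λ z → z ∉ S) → ¬ 2 ≤ ∣ edgesOf G S ∣ → IsLoopComponent G S
  loop-component {S} cS@((u , u∈S) , _) (z , z∉S) few =
    cS , unique⇒∣p∣≡1 u∈S (λ w∈S → ∣p∣<2⇒unique one-vertex w∈S u∈S)
       , unique⇒∣p∣≡1 e∈A (λ i∈A → ∣p∣<2⇒unique few i∈A e∈A)
    where
    A = edgesOf G S
    e∈A = proj₂ (some-edge cS)
    f∈∁A : proj₁ (ni z) ∈ ∁ A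
    f∈∁A = x∉p⇒x∈∁p λ f∈A → z∉S (∈edgesOf∧Incident⇒∈ (component-closed cS) f∈A (proj₂ (ni z)))

    one-vertex : ¬ 2 ≤ ∣ S ∣
    one-vertex many = tc 1 (s≤s (s≤s z≤n)) A (x∈p⇒0<∣p∣ e∈A , x∈p⇒0<∣p∣ f∈∁A , bound)
      where
      bound : rank M A + rank M (∁ A) < rank M ⊤ + 1
      bound = begin-strict
        rank M A + rank M (∁ A)  ≤⟨ +-monoˡ-≤ _ (≤-trans (rank-≤-card M A) (≤-pred (≰⇒> few))) ⟩
        1 + rank M (∁ A)         <⟨ +-monoˡ-≤ (rank M (∁ A)) many ⟩
        ∣ S ∣ + rank M (∁ A)     ≡⟨ +-comm ∣ S ∣ _ ⟩
        rank M (∁ A) + ∣ S ∣     ≤⟨ rank∁edgesOf+∣S∣≤rank+1 cS ⟩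
        rank M ⊤ + 1             ∎

  TwoComponentsOneLoop : Set
  TwoComponentsOneLoop = ∃ λ (S₁ : Subset m) → ∃ λ (S₂ : Subset m) →
    IsComponent G S₁ × IsComponent G S₂ × S₁ ≢ S₂ ×
    (∀ S → IsComponent G S → S ≡ S₁ ⊎ S ≡ S₂) ×
    IsLoopComponent G S₁

  two-components : NoSpanningComponent →
    (∃ λ S → IsComponent G S × 2 ≤ ∣ edgesOf G S ∣) → TwoComponentsOneLoop
  two-components outside (S , cS , many) with outside cS
  ... | z , z∉S with component z
  ...   | D , cD , z∈D = D , S , cD , cS , D≢S , D-or-S , loop-component cD (outside cD) few
    where
    few-outside = 2≤∣edgesOf∣⇒∣∁edgesOf∣<2 cS many
    D≢S : D ≢ S
    D≢S D≡S = z∉S (subst (z ∈_) D≡S z∈D)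
    few : ¬ 2 ≤ ∣ edgesOf G D ∣
    few many-D = few-outside (≤-trans many-D (p⊆q⇒∣p∣≤∣q∣ (≢⇒edgesOf⊆∁edgesOf cS cD (≢-sym D≢S))))

    -- A component other than S has an edge outside edgesOf S, which must be D's.
    D-or-S : ∀ T → IsComponent G T → T ≡ D ⊎ T ≡ S
    D-or-S T cT with ≡-dec Bool._≟_ T S
    ... | yes T≡S = inj₂ T≡S
    ... | no  T≢S = inj₁ (edgesOf-meet⇒≡ cT cD f∈T (subst (_∈ edgesOf G D) (sym f≡e) e∈D))
      where
      f∈T = proj₂ (some-edge cT)
      e∈D = proj₂ (some-edge cD)
      f≡e = ∣p∣<2⇒unique few-outside (≢⇒edgesOf⊆∁edgesOf cS cT (≢-sym T≢S) f∈T)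
                                (≢⇒edgesOf⊆∁edgesOf cS cD (≢-sym D≢S) e∈D)

  all-loop-components : NoSpanningComponent → (∀ {S} → IsComponent G S → ¬ 2 ≤ ∣ edgesOf G S ∣) →
    ∀ S → IsComponent G S → IsLoopComponent G S
  all-loop-components outside few S cS = loop-component cS (outside cS) (few cS)

  some-component-with-2-edges-or-none :
    (∃ λ S → IsComponent G S × 2 ≤ ∣ edgesOf G S ∣) ⊎ (∀ {S} → IsComponent G S → ¬ 2 ≤ ∣ edgesOf G S ∣)
  some-component-with-2-edges-or-none with any? (λ x → 2 ≤? ∣ edgesOf G (proj₁ (component x)) ∣)
  ... | yes (x , many) = inj₁ (_ , proj₁ (proj₂ (component x)) , many)
  ... | no none = inj₂ λ cS many → none (_ , subst (λ T → 2 ≤ ∣ edgesOf G T ∣) (≡component cS) many)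
    where
    ≡component : ∀ {S} (cS : IsComponent G S) → S ≡ proj₁ (component (proj₁ (proj₁ cS)))
    ≡component cS@((u , u∈S) , _) =
      component-≡ cS (proj₁ (proj₂ (component u))) u∈S (proj₂ (proj₂ (component u)))

lemma3p5 : ∀ {m n} (M : Matroid n) (G : Graph m n) →
    ThreeConnected M → 4 ≤ n → IsWeakFramework G M → NoIsolatedVertices G →
    Connected G
    ⊎ (∃ λ (S₁ : Subset m) → ∃ λ (S₂ : Subset m) →
         IsComponent G S₁ × IsComponent G S₂ × S₁ ≢ S₂ ×
         (∀ S → IsComponent G S → S ≡ S₁ ⊎ S ≡ S₂) ×
         IsLoopComponent G S₁)
    ⊎ (∀ S → IsComponent G S → IsLoopComponent G S)
lemma3p5 M G tc (s≤s _) fw ni =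
  Sum.map₂ (λ (outside : NoSpanningComponent) →
              Sum.map (two-components outside) (all-loop-components outside)
                      some-component-with-2-edges-or-none)
           (connected-or-noSpanningComponent (end₁ fzero))
  where
  open GraphComponents G
  open ThreeConnectedFramework {M = M} {G = G} tc fw ni
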